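{- Let $\{A_n\}_{n\ge0}$ be a sequence and $n$ a nonnegative integer. If $\{A_n\}$ is an even sequence and $n$ is odd, or if $\{A_n\}$ is an odd sequence and $n$ is even, then $$\sum_{k=0}^n\binom nk\binom{n+k}{k}(-1)^kA_k=0.$$
   Context: A sequence $\{a_n\}_{n\ge0}$ of real (or complex) numbers is called an even sequence if $\sum_{k=0}^n\binom nk(-1)^ka_k=a_n$ for all $n=0,1,2,\ldots$, and an odd sequence if $\sum_{k=0}^n\binom nk(-1)^ka_k=-a_n$ for all $n=0,1,2,\ldots$. -}

module Defs where

open import Level using (Level)
open import Data.Nat using (ℕ; zero; suc)
import Data.Nat
open import Data.Nat.Combinatorics using (_C_)
open import Algebra.Bundles using (CommutativeRing)
import Algebra.Definitions.RawMonoid as RM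

module _ {c ℓ : Level} (R : CommutativeRing c ℓ) where
  open CommutativeRing R

  open RM +-rawMonoid using (_×_)

  sgn : ℕ → Carrier
  sgn zero    = 1#
  sgn (suc k) = - (sgn k)

  sumTo : ℕ → (ℕ → Carrier) → Carrier
  sumTo zero    f = f 0
  sumTo (suc n) f = sumTo n f + f (suc n)

  binomTrans : (ℕ → Carrier) → ℕ → Carrier
  binomTrans a n = sumTo n (λ k → (n C k) × (sgn k * a k))

  IsEvenSeq : (ℕ → Carrier) → Set ℓ
  IsEvenSeq a = ∀ n → binomTrans a n ≈ a n

  IsOddSeq : (ℕ → Carrier) → Set ℓ
  IsOddSeq a = ∀ n → binomTrans a n ≈ - (a n)

  thmSum : (ℕ → Carrier) → ℕ → Carrier
  thmSum A n = sumTo n (λ k → ((n C k) Data.Nat.* ((n Data.Nat.+ k) C k)) × (sgn k * A k))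

{-# OPTIONS --safe #-}
module Submission where

-- Write S_n(A) = Σ_k C(n,k) C(n+k,k) (-1)^k A_k and T for the binomial transform.
-- The heart of the proof is S_n(T B) = (-1)^n S_n(B) for every sequence B: after
-- swapping the double sum this is Σ_k C(n,k) C(n+k,k) C(k,j) (-1)^k = (-1)^n C(n,j) C(n+j,j),
-- which trinomial revision turns into the alternating sum Σ_l C(m,l) (-1)^l C(l+N, m+r)
-- = (-1)^m C(N,r), an m-fold application of Pascal's rule.
-- Now let T A = -(-1)^n A.  Taking B = A only gives 2 S_n(A) = 0, which is useless in
-- characteristic 2.  Instead take B_k = A_k - A_{k+1}: by Pascal's rule (T B)_k = (T A)_{k+1}
-- = -(-1)^n A_{k+1}, and the identity becomes -(-1)^n S_n(A∘suc) = (-1)^n (S_n(A) - S_n(A∘suc)),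
-- i.e. (-1)^n S_n(A) = 0.

open import Defs
open import Level using (Level)
open import Data.Nat using (ℕ; zero; suc; _<_; _≤_; z≤n; s≤s; _%_)
import Data.Nat as ℕ
open import Data.Nat.Properties using (*-zeroʳ; m≤n⇒m<n∨m≡n; m≤n⇒m≤1+n; ≤-refl; m≤n⇒∃[o]m+o≡n)
open import Data.Nat.Combinatorics using (_C_; k>n⇒nCk≡0; nCk+nC[k+1]≡[n+1]C[k+1])
open import Data.Product using (_,_)
open import Data.Sum using (_⊎_; inj₁; inj₂)
open import Function using (_∘_)
open import Relation.Binary.PropositionalEquality using (_≡_)
import Relation.Binary.PropositionalEquality as ≡
open import Algebra.Bundles using (CommutativeRing)

module Binomial where
  open import Data.Nat using (_+_; _*_; _∸_; _!; _≤?_)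
  open import Data.Nat.Properties
  open import Data.Nat.Combinatorics using (nCk≡n!/k![n-k]!; k![n∸k]!∣n!; nCk≡nC[n∸k])
  open import Data.Nat.DivMod using (_/_; m/n*n≡m)
  open import Data.Nat.Tactic.RingSolver using (solve-∀)
  open import Relation.Nullary using (yes; no)
  open import Relation.Binary.PropositionalEquality
  open ≡-Reasoning

  C-factorial : ∀ a b → ((a + b) C a) * (a ! * b !) ≡ (a + b) !
  C-factorial a b = begin
    ((a + b) C a) * (a ! * b !)           ≡⟨ cong (λ d → ((a + b) C a) * (a ! * d !)) (m+n∸m≡n a b) ⟨
    ((a + b) C a) * (a ! * (a + b ∸ a) !) ≡⟨ cong (_* (a ! * (a + b ∸ a) !)) (nCk≡n!/k![n-k]! a≤a+b) ⟩
    (a + b) ! / (a ! * (a + b ∸ a) !) * (a ! * (a + b ∸ a) !) ≡⟨ m/n*n≡m (k![n∸k]!∣n! a≤a+b) ⟩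
    (a + b) !                             ∎
    where
    a≤a+b = m≤m+n a b
    instance _ = a !* (a + b ∸ a) !≢0

  C-sym : ∀ a b → (a + b) C a ≡ (a + b) C b
  C-sym a b = trans (nCk≡nC[n∸k] (m≤m+n a b)) (cong ((a + b) C_) (m+n∸m≡n a b))

  C-trinomial-+ : ∀ j l d → ((j + (l + d)) C (j + l)) * ((j + l) C j) ≡ ((j + (l + d)) C j) * ((l + d) C l)
  C-trinomial-+ j l d = *-cancelʳ-≡ _ _ (j ! * (l ! * d !)) {{m*n≢0 _ _ {{j !≢0}} {{l !* d !≢0}}}} (begin
    (P * Q) * (j ! * (l ! * d !))   ≡⟨ rearrange₁ P Q (j !) (l !) (d !) ⟩
    P * ((Q * (j ! * l !)) * d !)   ≡⟨ cong (λ x → P * (x * d !)) (C-factorial j l) ⟩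
    P * ((j + l) ! * d !)           ≡⟨ P-factorial ⟩
    (j + (l + d)) !                 ≡⟨ C-factorial j (l + d) ⟨
    P′ * (j ! * (l + d) !)          ≡⟨ cong (λ x → P′ * (j ! * x)) (C-factorial l d) ⟨
    P′ * (j ! * (Q′ * (l ! * d !))) ≡⟨ rearrange₂ P′ Q′ (j !) (l !) (d !) ⟩
    (P′ * Q′) * (j ! * (l ! * d !)) ∎)
    where
    P = (j + (l + d)) C (j + l)
    Q = (j + l) C j
    P′ = (j + (l + d)) C j
    Q′ = (l + d) C l
    P-factorial : P * ((j + l) ! * d !) ≡ (j + (l + d)) !
    P-factorial = subst (λ n → (n C (j + l)) * ((j + l) ! * d !) ≡ n !) (+-assoc j l d) (C-factorial (j + l) d)
    rearrange₁ : ∀ p q x y z → (p * q) * (x * (y * z)) ≡ p * ((q * (x * y)) * z)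
    rearrange₁ = solve-∀
    rearrange₂ : ∀ p q x y z → p * (x * (q * (y * z))) ≡ (p * q) * (x * (y * z))
    rearrange₂ = solve-∀

  C-trinomial : ∀ j m l → ((j + m) C (j + l)) * ((j + l) C j) ≡ ((j + m) C j) * (m C l)
  C-trinomial j m l with l ≤? m
  ... | yes l≤m with d , refl ← m≤n⇒∃[o]m+o≡n l≤m = C-trinomial-+ j l d
  ... | no l≰m = begin
    ((j + m) C (j + l)) * ((j + l) C j) ≡⟨ cong (_* ((j + l) C j)) (k>n⇒nCk≡0 (+-monoʳ-< j m<l)) ⟩
    0                                   ≡⟨ *-zeroʳ ((j + m) C j) ⟨
    ((j + m) C j) * 0                   ≡⟨ cong (((j + m) C j) *_) (k>n⇒nCk≡0 m<l) ⟨
    ((j + m) C j) * (m C l)             ∎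
    where m<l = ≰⇒> l≰m

  legendreCoeff : ℕ → ℕ → ℕ
  legendreCoeff n k = (n C k) * ((n + k) C k)

  legendreCoeff-*-C : ∀ j m l →
    legendreCoeff (j + m) (j + l) * ((j + l) C j) ≡ ((j + m) C j) * ((m C l) * ((l + (j + m + j)) C (m + j)))
  legendreCoeff-*-C j m l = begin
    ((n C k) * ((n + k) C k)) * (k C j) ≡⟨ *-comm-middle (n C k) ((n + k) C k) (k C j) ⟩
    ((n C k) * (k C j)) * ((n + k) C k) ≡⟨ cong₂ _*_ (C-trinomial j m l) (sym (C-sym n k)) ⟩
    ((n C j) * (m C l)) * ((n + k) C n) ≡⟨ cong₂ (λ a b → ((n C j) * (m C l)) * (a C b)) (reassociate j m l) (+-comm j m) ⟩
    ((n C j) * (m C l)) * ((l + (n + j)) C (m + j)) ≡⟨ *-assoc (n C j) (m C l) _ ⟩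
    (n C j) * ((m C l) * ((l + (n + j)) C (m + j))) ∎
    where
    n = j + m
    k = j + l
    *-comm-middle : ∀ a b c → (a * b) * c ≡ (a * c) * b
    *-comm-middle = solve-∀
    reassociate : ∀ j m l → (j + m) + (j + l) ≡ l + ((j + m) + j)
    reassociate = solve-∀

open Binomial using (legendreCoeff; legendreCoeff-*-C)

module _ {c ℓ : Level} (R : CommutativeRing c ℓ) where
  open CommutativeRing R
  open import Algebra.Properties.Ring ring using (-‿distribˡ-*; -‿distribʳ-*; -‿involutive; -‿+-comm)
  open import Algebra.Properties.Semiring.Mult semiring using (_×_; ×-homo-+; ×-homo-1; ×1-homo-*; ×-assoc-*; ×-congʳ)
  open import Algebra.Properties.CommutativeSemigroup +-commutativeSemigroup using (interchange; x∙yz≈xz∙y)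
  open import Algebra.Solver.CommutativeMonoid *-commutativeMonoid using (solve; _⊜_) renaming (_⊕_ to _⊗_)
  open import Algebra.Properties.AbelianGroup +-abelianGroup using (xyx⁻¹≈y; //-rightDividesˡ)
  open import Relation.Binary.Reasoning.Setoid setoid

  sumTo-cong : ∀ n {f g : ℕ → Carrier} → (∀ k → k ≤ n → f k ≈ g k) → sumTo R n f ≈ sumTo R n g
  sumTo-cong zero    f≈g = f≈g 0 z≤n
  sumTo-cong (suc n) f≈g = +-cong (sumTo-cong n (λ k k≤n → f≈g k (m≤n⇒m≤1+n k≤n))) (f≈g (suc n) ≤-refl)

  sumTo-+ : ∀ n (f g : ℕ → Carrier) → sumTo R n (λ k → f k + g k) ≈ sumTo R n f + sumTo R n g
  sumTo-+ zero    f g = refl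
  sumTo-+ (suc n) f g = trans (+-congʳ (sumTo-+ n f g)) (interchange _ _ _ _)

  sumTo-neg : ∀ n (f : ℕ → Carrier) → sumTo R n (λ k → - f k) ≈ - sumTo R n f
  sumTo-neg zero    f = refl
  sumTo-neg (suc n) f = trans (+-congʳ (sumTo-neg n f)) (-‿+-comm _ _)

  *-distribˡ-sumTo : ∀ n x (f : ℕ → Carrier) → x * sumTo R n f ≈ sumTo R n (λ k → x * f k)
  *-distribˡ-sumTo zero    x f = refl
  *-distribˡ-sumTo (suc n) x f = trans (distribˡ x _ _) (+-congʳ (*-distribˡ-sumTo n x f))

  *-distribʳ-sumTo : ∀ n x (f : ℕ → Carrier) → sumTo R n f * x ≈ sumTo R n (λ k → f k * x)
  *-distribʳ-sumTo zero    x f = refl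
  *-distribʳ-sumTo (suc n) x f = trans (distribʳ x _ _) (+-congʳ (*-distribʳ-sumTo n x f))

  sumTo-swap : ∀ m n (f : ℕ → ℕ → Carrier) →
               sumTo R m (λ i → sumTo R n (f i)) ≈ sumTo R n (λ j → sumTo R m (λ i → f i j))
  sumTo-swap zero    n f = refl
  sumTo-swap (suc m) n f = trans (+-congʳ (sumTo-swap m n f)) (sym (sumTo-+ n _ (f (suc m))))

  sumTo-head : ∀ n (f : ℕ → Carrier) → sumTo R (suc n) f ≈ f 0 + sumTo R n (f ∘ suc)
  sumTo-head zero    f = refl
  sumTo-head (suc n) f = trans (+-congʳ (sumTo-head n f)) (+-assoc _ _ _)

  sumTo-vanishingTail : ∀ {m n} (f : ℕ → Carrier) → m ≤ n → (∀ k → m < k → f k ≈ 0#) → sumTo R n f ≈ sumTo R m f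
  sumTo-vanishingTail f m≤n f≈0 with m≤n⇒m<n∨m≡n m≤n
  ... | inj₂ ≡.refl = refl
  sumTo-vanishingTail {m} {suc n} f _ f≈0 | inj₁ (s≤s m≤n) = begin
    sumTo R n f + f (suc n) ≈⟨ +-cong (sumTo-vanishingTail f m≤n f≈0) (f≈0 (suc n) (s≤s m≤n)) ⟩
    sumTo R m f + 0#        ≈⟨ +-identityʳ _ ⟩
    sumTo R m f             ∎

  sumTo-vanishingHead : ∀ j m (f : ℕ → Carrier) → (∀ k → k < j → f k ≈ 0#) →
                        sumTo R (j ℕ.+ m) f ≈ sumTo R m (λ l → f (j ℕ.+ l))
  sumTo-vanishingHead zero    m f f≈0 = refl
  sumTo-vanishingHead (suc j) m f f≈0 = begin
    sumTo R (suc (j ℕ.+ m)) f              ≈⟨ sumTo-head (j ℕ.+ m) f ⟩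
    f 0 + sumTo R (j ℕ.+ m) (f ∘ suc)      ≈⟨ +-cong (f≈0 0 (s≤s z≤n)) tail≈ ⟩
    0# + sumTo R m (λ l → f (suc j ℕ.+ l)) ≈⟨ +-identityˡ _ ⟩
    sumTo R m (λ l → f (suc j ℕ.+ l))      ∎
    where
    tail≈ = sumTo-vanishingHead j m (f ∘ suc) (λ k k<j → f≈0 (suc k) (s≤s k<j))

  sgn-+ : ∀ a b → sgn R (a ℕ.+ b) ≈ sgn R a * sgn R b
  sgn-+ zero    b = sym (*-identityˡ _)
  sgn-+ (suc a) b = trans (-‿cong (sgn-+ a b)) (-‿distribˡ-* _ _)

  sgn*sgn≈1 : ∀ n → sgn R n * sgn R n ≈ 1#
  sgn*sgn≈1 zero    = *-identityˡ 1#
  sgn*sgn≈1 (suc n) = trans (-x*-x≈x*x (sgn R n)) (sgn*sgn≈1 n)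
    where
    -x*-x≈x*x : ∀ x → - x * - x ≈ x * x
    -x*-x≈x*x x = trans (sym (-‿distribˡ-* x (- x))) (trans (-‿cong (sym (-‿distribʳ-* x x))) (-‿involutive _))

  sgn-even : ∀ n → n % 2 ≡ 0 → sgn R n ≈ 1#
  sgn-even zero          _ = refl
  sgn-even (suc (suc n)) p = trans (-‿involutive _) (sgn-even n p)

  sgn-odd : ∀ n → n % 2 ≡ 1 → sgn R n ≈ - 1#
  sgn-odd (suc zero)    _ = refl
  sgn-odd (suc (suc n)) p = trans (-‿involutive _) (sgn-odd n p)

  ⌜_⌝ : ℕ → Carrier
  ⌜ n ⌝ = n × 1#

  ⌜⌝-cong : ∀ {m n} → m ≡ n → ⌜ m ⌝ ≈ ⌜ n ⌝
  ⌜⌝-cong m≡n = reflexive (≡.cong ⌜_⌝ m≡n)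

  ×≈⌜⌝* : ∀ n x → n × x ≈ ⌜ n ⌝ * x
  ×≈⌜⌝* n x = sym (trans (×-assoc-* n 1# x) (×-congʳ n (*-identityˡ x)))

  alternatingSum : ℕ → (ℕ → ℕ) → (ℕ → Carrier) → Carrier
  alternatingSum n w a = sumTo R n (λ k → ⌜ w k ⌝ * (sgn R k * a k))

  binomTrans≈alternatingSum : ∀ a n → binomTrans R a n ≈ alternatingSum n (n C_) a
  binomTrans≈alternatingSum a n = sumTo-cong n (λ k _ → ×≈⌜⌝* (n C k) _)

  thmSum≈alternatingSum : ∀ A n → thmSum R A n ≈ alternatingSum n (legendreCoeff n) A
  thmSum≈alternatingSum A n = sumTo-cong n (λ k _ → ×≈⌜⌝* (legendreCoeff n k) _)

  module _ (n : ℕ) (w : ℕ → ℕ) where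

    alternatingSum-cong : ∀ {a b} → (∀ k → k ≤ n → a k ≈ b k) → alternatingSum n w a ≈ alternatingSum n w b
    alternatingSum-cong a≈b = sumTo-cong n (λ k k≤n → *-congˡ (*-congˡ (a≈b k k≤n)))

    alternatingSum-+ : ∀ a b → alternatingSum n w (λ k → a k + b k) ≈ alternatingSum n w a + alternatingSum n w b
    alternatingSum-+ a b = trans (sumTo-cong n (λ k _ → distrib-+ (⌜ w k ⌝) (sgn R k) (a k) (b k))) (sumTo-+ n _ _)
      where
      distrib-+ : ∀ u s x y → u * (s * (x + y)) ≈ u * (s * x) + u * (s * y)
      distrib-+ u s x y = trans (*-congˡ (distribˡ s x y)) (distribˡ u (s * x) (s * y))

    alternatingSum-neg : ∀ a → alternatingSum n w (λ k → - a k) ≈ - alternatingSum n w a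
    alternatingSum-neg a = trans (sumTo-cong n (λ k _ → distrib-neg (⌜ w k ⌝) (sgn R k) (a k))) (sumTo-neg n _)
      where
      distrib-neg : ∀ u s x → u * (s * - x) ≈ - (u * (s * x))
      distrib-neg u s x = trans (*-congˡ (sym (-‿distribʳ-* s x))) (sym (-‿distribʳ-* u (s * x)))

    alternatingSum-*ˡ : ∀ x a → x * alternatingSum n w a ≈ alternatingSum n w (λ k → x * a k)
    alternatingSum-*ˡ x a = trans (*-distribˡ-sumTo n x _) (sumTo-cong n (λ k _ → move-in x (⌜ w k ⌝) (sgn R k) (a k)))
      where
      move-in : ∀ x u s y → x * (u * (s * y)) ≈ u * (s * (x * y))
      move-in = solve 4 (λ x u s y → (x ⊗ (u ⊗ (s ⊗ y))) ⊜ (u ⊗ (s ⊗ (x ⊗ y)))) refl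

  ⌜C⌝≈0 : ∀ {n k} → n < k → ∀ x → ⌜ n C k ⌝ * x ≈ 0#
  ⌜C⌝≈0 n<k x = trans (*-congʳ (⌜⌝-cong (k>n⇒nCk≡0 n<k))) (zeroˡ x)

  sumTo-pascal : ∀ m (h : ℕ → Carrier) →
    sumTo R (suc m) (λ l → ⌜ suc m C l ⌝ * h l)
      ≈ sumTo R m (λ l → ⌜ m C l ⌝ * h l) + sumTo R m (λ l → ⌜ m C l ⌝ * h (suc l))
  sumTo-pascal m h = begin
    sumTo R (suc m) (λ l → ⌜ suc m C l ⌝ * h l)
      ≈⟨ sumTo-head m _ ⟩
    ⌜ m C 0 ⌝ * h 0 + sumTo R m (λ l → ⌜ suc m C suc l ⌝ * h (suc l))
      ≈⟨ +-congˡ (trans (sumTo-cong m (λ l _ → pascal l)) (sumTo-+ m _ _)) ⟩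
    ⌜ m C 0 ⌝ * h 0 + (S₀ + S₁)
      ≈⟨ x∙yz≈xz∙y _ S₀ S₁ ⟩
    (⌜ m C 0 ⌝ * h 0 + S₁) + S₀
      ≈⟨ +-congʳ (sumTo-head m _) ⟨
    sumTo R (suc m) (λ l → ⌜ m C l ⌝ * h l) + S₀
      ≈⟨ +-congʳ (sumTo-vanishingTail _ (m≤n⇒m≤1+n ≤-refl) (λ l m<l → ⌜C⌝≈0 m<l (h l))) ⟩
    sumTo R m (λ l → ⌜ m C l ⌝ * h l) + S₀ ∎
    where
    S₀ = sumTo R m (λ l → ⌜ m C l ⌝ * h (suc l))
    S₁ = sumTo R m (λ l → ⌜ m C suc l ⌝ * h (suc l))
    pascal : ∀ l → ⌜ suc m C suc l ⌝ * h (suc l) ≈ ⌜ m C l ⌝ * h (suc l) + ⌜ m C suc l ⌝ * h (suc l)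
    pascal l = begin
      ⌜ suc m C suc l ⌝ * h (suc l)                     ≈⟨ *-congʳ (⌜⌝-cong (nCk+nC[k+1]≡[n+1]C[k+1] m l)) ⟨
      ⌜ m C l ℕ.+ m C suc l ⌝ * h (suc l)               ≈⟨ *-congʳ (×-homo-+ 1# (m C l) (m C suc l)) ⟩
      (⌜ m C l ⌝ + ⌜ m C suc l ⌝) * h (suc l)           ≈⟨ distribʳ _ _ _ ⟩
      ⌜ m C l ⌝ * h (suc l) + ⌜ m C suc l ⌝ * h (suc l) ∎

  alternatingSum-pascal : ∀ m a → alternatingSum (suc m) (suc m C_) a ≈ alternatingSum m (m C_) (λ l → a l - a (suc l))
  alternatingSum-pascal m a = begin
    alternatingSum (suc m) (suc m C_) a
      ≈⟨ sumTo-pascal m (λ l → sgn R l * a l) ⟩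
    alternatingSum m (m C_) a + sumTo R m (λ l → ⌜ m C l ⌝ * (- sgn R l * a (suc l)))
      ≈⟨ +-congˡ (sumTo-cong m (λ l _ → *-congˡ (trans (sym (-‿distribˡ-* _ _)) (-‿distribʳ-* _ _)))) ⟩
    alternatingSum m (m C_) a + alternatingSum m (m C_) (λ l → - a (suc l))
      ≈⟨ alternatingSum-+ m (m C_) a (λ l → - a (suc l)) ⟨
    alternatingSum m (m C_) (λ l → a l - a (suc l)) ∎

  -- Indices are written l + N and m + r so that suc l + N and suc m + r reduce to
  -- suc (l + N) and suc (m + r), the shape in which Pascal's rule applies.
  alternatingSum-C-column : ∀ m N r → alternatingSum m (m C_) (λ l → ⌜ (l ℕ.+ N) C (m ℕ.+ r) ⌝) ≈ sgn R m * ⌜ N C r ⌝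
  alternatingSum-C-column zero    N r = trans (*-congʳ (×-homo-1 1#)) (*-identityˡ _)
  alternatingSum-C-column (suc m) N r = begin
    alternatingSum (suc m) (suc m C_) column
      ≈⟨ alternatingSum-pascal m column ⟩
    alternatingSum m (m C_) (λ l → column l - column (suc l))
      ≈⟨ alternatingSum-cong m (m C_) (λ l _ → pascal-difference (l ℕ.+ N) (m ℕ.+ r)) ⟩
    alternatingSum m (m C_) (λ l → - ⌜ (l ℕ.+ N) C (m ℕ.+ r) ⌝)
      ≈⟨ alternatingSum-neg m (m C_) _ ⟩
    - alternatingSum m (m C_) (λ l → ⌜ (l ℕ.+ N) C (m ℕ.+ r) ⌝)
      ≈⟨ -‿cong (alternatingSum-C-column m N r) ⟩
    - (sgn R m * ⌜ N C r ⌝)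
      ≈⟨ -‿distribˡ-* _ _ ⟩
    - sgn R m * ⌜ N C r ⌝ ∎
    where
    column : ℕ → Carrier
    column l = ⌜ (l ℕ.+ N) C (suc m ℕ.+ r) ⌝
    y-[x+y]≈-x : ∀ x y → y - (x + y) ≈ - x
    y-[x+y]≈-x x y = trans (+-congˡ (sym (-‿+-comm x y))) (trans (sym (+-assoc y (- x) (- y))) (xyx⁻¹≈y y (- x)))
    pascal-difference : ∀ p q → ⌜ p C suc q ⌝ - ⌜ suc p C suc q ⌝ ≈ - ⌜ p C q ⌝
    pascal-difference p q = begin
      ⌜ p C suc q ⌝ - ⌜ suc p C suc q ⌝           ≈⟨ +-congˡ (-‿cong (⌜⌝-cong (nCk+nC[k+1]≡[n+1]C[k+1] p q))) ⟨
      ⌜ p C suc q ⌝ - ⌜ p C q ℕ.+ p C suc q ⌝     ≈⟨ +-congˡ (-‿cong (×-homo-+ 1# (p C q) (p C suc q))) ⟩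
      ⌜ p C suc q ⌝ - (⌜ p C q ⌝ + ⌜ p C suc q ⌝) ≈⟨ y-[x+y]≈-x ⌜ p C q ⌝ ⌜ p C suc q ⌝ ⟩
      - ⌜ p C q ⌝                                 ∎

  legendreSum-C : ∀ {n j} → j ≤ n →
    sumTo R n (λ k → ⌜ legendreCoeff n k ℕ.* (k C j) ⌝ * sgn R k) ≈ sgn R n * ⌜ legendreCoeff n j ⌝
  legendreSum-C {j = j} j≤n with m , ≡.refl ← m≤n⇒∃[o]m+o≡n j≤n = begin
    sumTo R n term
      ≈⟨ sumTo-vanishingHead j m term (λ k k<j → below-j k<j) ⟩
    sumTo R m (λ l → term (j ℕ.+ l))
      ≈⟨ sumTo-cong m (λ l _ → shifted-term l) ⟩
    sumTo R m (λ l → (⌜ n C j ⌝ * sgn R j) * (⌜ m C l ⌝ * (sgn R l * ⌜ (l ℕ.+ (n ℕ.+ j)) C (m ℕ.+ j) ⌝)))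
      ≈⟨ *-distribˡ-sumTo m _ _ ⟨
    (⌜ n C j ⌝ * sgn R j) * alternatingSum m (m C_) (λ l → ⌜ (l ℕ.+ (n ℕ.+ j)) C (m ℕ.+ j) ⌝)
      ≈⟨ *-congˡ (alternatingSum-C-column m (n ℕ.+ j) j) ⟩
    (⌜ n C j ⌝ * sgn R j) * (sgn R m * ⌜ (n ℕ.+ j) C j ⌝)
      ≈⟨ regroup ⌜ n C j ⌝ (sgn R j) (sgn R m) ⌜ (n ℕ.+ j) C j ⌝ ⟩
    (sgn R j * sgn R m) * (⌜ n C j ⌝ * ⌜ (n ℕ.+ j) C j ⌝)
      ≈⟨ *-cong (sgn-+ j m) (×1-homo-* (n C j) ((n ℕ.+ j) C j)) ⟨
    sgn R n * ⌜ legendreCoeff n j ⌝ ∎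
    where
    n = j ℕ.+ m
    term : ℕ → Carrier
    term k = ⌜ legendreCoeff n k ℕ.* (k C j) ⌝ * sgn R k
    below-j : ∀ {k} → k < j → term k ≈ 0#
    below-j {k} k<j = trans (*-congʳ (⌜⌝-cong L*C≡0)) (zeroˡ _)
      where
      L*C≡0 : legendreCoeff n k ℕ.* (k C j) ≡ 0
      L*C≡0 = ≡.trans (≡.cong (legendreCoeff n k ℕ.*_) (k>n⇒nCk≡0 k<j)) (*-zeroʳ (legendreCoeff n k))
    regroup : ∀ a s t b → (a * s) * (t * b) ≈ (s * t) * (a * b)
    regroup = solve 4 (λ a s t b → ((a ⊗ s) ⊗ (t ⊗ b)) ⊜ ((s ⊗ t) ⊗ (a ⊗ b))) refl
    shifted-term : ∀ l →
      term (j ℕ.+ l) ≈ (⌜ n C j ⌝ * sgn R j) * (⌜ m C l ⌝ * (sgn R l * ⌜ (l ℕ.+ (n ℕ.+ j)) C (m ℕ.+ j) ⌝))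
    shifted-term l = begin
      term (j ℕ.+ l)
        ≈⟨ *-cong (⌜⌝-cong (legendreCoeff-*-C j m l)) (sgn-+ j l) ⟩
      ⌜ (n C j) ℕ.* ((m C l) ℕ.* X) ⌝ * (sgn R j * sgn R l)
        ≈⟨ *-congʳ (trans (×1-homo-* (n C j) _) (*-congˡ (×1-homo-* (m C l) X))) ⟩
      (⌜ n C j ⌝ * (⌜ m C l ⌝ * ⌜ X ⌝)) * (sgn R j * sgn R l)
        ≈⟨ regroup′ ⌜ n C j ⌝ ⌜ m C l ⌝ ⌜ X ⌝ (sgn R j) (sgn R l) ⟩
      (⌜ n C j ⌝ * sgn R j) * (⌜ m C l ⌝ * (sgn R l * ⌜ X ⌝)) ∎
      where
      X = (l ℕ.+ (n ℕ.+ j)) C (m ℕ.+ j)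
      regroup′ : ∀ a b x s t → (a * (b * x)) * (s * t) ≈ (a * s) * (b * (t * x))
      regroup′ = solve 5 (λ a b x s t → ((a ⊗ (b ⊗ x)) ⊗ (s ⊗ t)) ⊜ ((a ⊗ s) ⊗ (b ⊗ (t ⊗ x)))) refl

  legendreSum-binomTrans : ∀ n B →
    alternatingSum n (legendreCoeff n) (λ k → alternatingSum k (k C_) B) ≈ sgn R n * alternatingSum n (legendreCoeff n) B
  legendreSum-binomTrans n B = begin
    alternatingSum n (legendreCoeff n) (λ k → alternatingSum k (k C_) B)
      ≈⟨ sumTo-cong n (λ k k≤n → expand k≤n) ⟩
    sumTo R n (λ k → sumTo R n (λ j → term k j))
      ≈⟨ sumTo-swap n n term ⟩
    sumTo R n (λ j → sumTo R n (λ k → term k j))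
      ≈⟨ sumTo-cong n (λ j j≤n → trans (sym (*-distribʳ-sumTo n _ _)) (*-congʳ (legendreSum-C j≤n))) ⟩
    sumTo R n (λ j → (sgn R n * ⌜ legendreCoeff n j ⌝) * (sgn R j * B j))
      ≈⟨ sumTo-cong n (λ j _ → *-assoc _ _ _) ⟩
    sumTo R n (λ j → sgn R n * (⌜ legendreCoeff n j ⌝ * (sgn R j * B j)))
      ≈⟨ *-distribˡ-sumTo n _ _ ⟨
    sgn R n * alternatingSum n (legendreCoeff n) B ∎
    where
    term : ℕ → ℕ → Carrier
    term k j = (⌜ legendreCoeff n k ℕ.* (k C j) ⌝ * sgn R k) * (sgn R j * B j)
    expand : ∀ {k} → k ≤ n →
      ⌜ legendreCoeff n k ⌝ * (sgn R k * alternatingSum k (k C_) B) ≈ sumTo R n (term k)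
    expand {k} k≤n = begin
      ⌜ legendreCoeff n k ⌝ * (sgn R k * alternatingSum k (k C_) B)
        ≈⟨ *-congˡ (*-congˡ (sumTo-vanishingTail _ k≤n (λ j k<j → ⌜C⌝≈0 k<j (sgn R j * B j)))) ⟨
      ⌜ legendreCoeff n k ⌝ * (sgn R k * alternatingSum n (k C_) B)
        ≈⟨ *-assoc _ _ _ ⟨
      (⌜ legendreCoeff n k ⌝ * sgn R k) * alternatingSum n (k C_) B
        ≈⟨ *-distribˡ-sumTo n _ _ ⟩
      sumTo R n (λ j → (⌜ legendreCoeff n k ⌝ * sgn R k) * (⌜ k C j ⌝ * (sgn R j * B j)))
        ≈⟨ sumTo-cong n (λ j _ → merge (⌜ legendreCoeff n k ⌝) (sgn R k) ⌜ k C j ⌝ (sgn R j * B j)) ⟩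
      sumTo R n (λ j → ((⌜ legendreCoeff n k ⌝ * ⌜ k C j ⌝) * sgn R k) * (sgn R j * B j))
        ≈⟨ sumTo-cong n (λ j _ → *-congʳ (*-congʳ (×1-homo-* (legendreCoeff n k) (k C j)))) ⟨
      sumTo R n (term k) ∎
      where
      merge : ∀ a s c t → (a * s) * (c * t) ≈ ((a * c) * s) * t
      merge = solve 4 (λ a s c t → ((a ⊗ s) ⊗ (c ⊗ t)) ⊜ (((a ⊗ c) ⊗ s) ⊗ t)) refl

  legendreSum-vanishes : ∀ n A → (∀ k → binomTrans R A k ≈ - sgn R n * A k) → thmSum R A n ≈ 0#
  legendreSum-vanishes n A eigen = begin
    thmSum R A n          ≈⟨ thmSum≈alternatingSum A n ⟩
    Y                     ≈⟨ *-identityˡ Y ⟨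
    1# * Y                ≈⟨ *-congʳ (sgn*sgn≈1 n) ⟨
    (s * s) * Y           ≈⟨ *-assoc s s Y ⟩
    s * (s * Y)           ≈⟨ *-congˡ sY≈0 ⟩
    s * 0#                ≈⟨ zeroʳ s ⟩
    0#                    ∎
    where
    s = sgn R n
    S : (ℕ → Carrier) → Carrier
    S = alternatingSum n (legendreCoeff n)
    Y = S A
    X = S (A ∘ suc)
    eigen′ : ∀ k → alternatingSum k (k C_) A ≈ - s * A k
    eigen′ k = trans (sym (binomTrans≈alternatingSum A k)) (eigen k)
    -sX≈s[Y-X] : - s * X ≈ s * (Y - X)
    -sX≈s[Y-X] = begin
      - s * X
        ≈⟨ alternatingSum-*ˡ n (legendreCoeff n) (- s) (A ∘ suc) ⟩
      S (λ k → - s * A (suc k))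
        ≈⟨ alternatingSum-cong n (legendreCoeff n) (λ k _ → eigen′ (suc k)) ⟨
      S (λ k → alternatingSum (suc k) (suc k C_) A)
        ≈⟨ alternatingSum-cong n (legendreCoeff n) (λ k _ → alternatingSum-pascal k A) ⟩
      S (λ k → alternatingSum k (k C_) (λ j → A j - A (suc j)))
        ≈⟨ legendreSum-binomTrans n (λ j → A j - A (suc j)) ⟩
      s * S (λ j → A j - A (suc j))
        ≈⟨ *-congˡ (alternatingSum-+ n (legendreCoeff n) A _) ⟩
      s * (Y + S (λ j → - A (suc j)))
        ≈⟨ *-congˡ (+-congˡ (alternatingSum-neg n (legendreCoeff n) (A ∘ suc))) ⟩
      s * (Y - X) ∎
    sY≈0 : s * Y ≈ 0#
    sY≈0 = begin
      s * Y                ≈⟨ *-congˡ (//-rightDividesˡ X Y) ⟨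
      s * ((Y - X) + X)    ≈⟨ distribˡ s (Y - X) X ⟩
      s * (Y - X) + s * X  ≈⟨ +-congʳ -sX≈s[Y-X] ⟨
      - s * X + s * X      ≈⟨ +-congʳ (-‿distribˡ-* s X) ⟨
      - (s * X) + s * X    ≈⟨ -‿inverseˡ (s * X) ⟩
      0#                   ∎

-- Opened only here: inside the ring module above, _×_ is the ℕ-action n × x of Defs.
open import Data.Product using (_×_)

theorem2p3 : {c ℓ : Level} (R : CommutativeRing c ℓ) (A : ℕ → CommutativeRing.Carrier R) (n : ℕ) →
    ((IsEvenSeq R A × n % 2 ≡ 1) ⊎ (IsOddSeq R A × n % 2 ≡ 0)) →
    CommutativeRing._≈_ R (thmSum R A n) (CommutativeRing.0# R)
theorem2p3 R A n (inj₁ (even , n-odd)) = legendreSum-vanishes R n A (λ k → trans (even k) (eigen k))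
  where
  open CommutativeRing R
  open import Algebra.Properties.Ring ring using (-‿involutive)
  eigen : ∀ k → A k ≈ - sgn R n * A k
  eigen k = trans (sym (*-identityˡ (A k))) (*-congʳ (sym (trans (-‿cong (sgn-odd R n n-odd)) (-‿involutive 1#))))
theorem2p3 R A n (inj₂ (odd , n-even)) = legendreSum-vanishes R n A (λ k → trans (odd k) (eigen k))
  where
  open CommutativeRing R
  open import Algebra.Properties.Ring ring using (-1*x≈-x)
  eigen : ∀ k → - A k ≈ - sgn R n * A k
  eigen k = trans (sym (-1*x≈-x (A k))) (*-congʳ (-‿cong (sym (sgn-even R n n-even))))
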